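{- Let $\alpha>0$ be an ordinal and $S\subseteq\mathbb{N}^\mathbb{N}$. If $S\in D_\alpha$ or $\mathbb{N}^\mathbb{N}\setminus S\in D_\alpha$, then $S$ is guessable with $<\alpha+1$ mind changes.
   Context: $\mathbb{N}^\mathbb{N}$ has the Baire space topology. $\mathbb{N}^{<\mathbb{N}}$ is the set of finite sequences; $f\upharpoonright n$ is the length-$n$ initial segment of $f$; $\chi_S$ is the characteristic function of $S$. $G:\mathbb{N}^{<\mathbb{N}}\to\{0,1\}$ is an $S$-guesser if $\lim_nG(f\upharpoonright n)=\chi_S(f)$ for all $f$. For an ordinal $\gamma$, $S$ is guessable with $<\gamma$ mind changes if there are an $S$-guesser $G$ and $H:\mathbb{N}^{<\mathbb{N}}\to\gamma$ such that for all $f,n$: $H(f\upharpoonright(n+1))\le H(f\upharpoonright n)$, and if $G(f\upharpoonright(n+1))\ne G(f\upharpoonright n)$ then $H(f\upharpoonright(n+1))<H(f\upharpoonright n)$. The parity of an ordinal $\eta=\lambda+n$ ($\lambda$ zero or limit, $n\in\mathbb{N}$) is $n\bmod2$. For $\theta\ge1$ and increasing $(A_\eta)_{\eta<\theta}$ of subsets of $\mathbb{N}^\mathbb{N}$, $x\in D_\theta((A_\eta)_{\eta<\theta})$ iff $x\in\bigcup_{\eta<\theta}A_\eta$ and the least $\eta$ with $x\in A_\eta$ has parity opposite to that of $\theta$; $D_\theta$ is the set of all such $D_\theta((A_\eta)_{\eta<\theta})$ with every $A_\eta$ open. -}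

module Defs where

open import Data.Nat using (ℕ; zero; suc; _≤_)
open import Data.Bool using (Bool; true; false; not)
open import Data.List using (List; applyUpTo)
open import Data.Product using (Σ; ∃; ∃-syntax; _×_)
open import Data.Sum using (_⊎_)
open import Relation.Nullary using (¬_)
open import Relation.Binary.PropositionalEquality using (_≡_)

Baire : Set
Baire = ℕ → ℕ

Seq : Set
Seq = List ℕ

_↾_ : Baire → ℕ → Seq
f ↾ n = applyUpTo f n

BSet : Set₁
BSet = Baire → Set

IsOpen : BSet → Set
IsOpen A = ∀ f → A f → ∃[ n ] (∀ g → g ↾ n ≡ f ↾ n → A g)

IsGuesser : BSet → (Seq → Bool) → Set
IsGuesser S G =
  ∀ f → (S f → ∃[ N ] (∀ n → N ≤ n → G (f ↾ n) ≡ true))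
      × (¬ S f → ∃[ N ] (∀ n → N ≤ n → G (f ↾ n) ≡ false))

-- Ordinals are elements of a well-ordered type (O, _<_) (assumed in the statement).
module _ {O : Set} (_<_ : O → O → Set) where

  _≤o_ : O → O → Set
  η ≤o ζ = η < ζ ⊎ η ≡ ζ

  IsSucc : O → O → Set
  IsSucc η' η = η' < η × (∀ ζ → ¬ (η' < ζ × ζ < η))

  -- parity of η = λ + n (λ zero or limit) is n mod 2; false = even (0), true = odd (1)
  data Parity : O → Bool → Set where
    zeroOrLimit : ∀ {η} → (∀ η' → ¬ IsSucc η' η) → Parity η false
    succ        : ∀ {η' η b} → IsSucc η' η → Parity η' b → Parity η (not b)

  InD : O → (O → BSet) → Baire → Set
  InD θ A x =
    ∃[ η ] (η < θ × A η x × (∀ ζ → ζ < η → ¬ A ζ x)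
           × ∃[ b ] (Parity η b × Parity θ (not b)))

  InClassD : O → BSet → Set₁
  InClassD θ S =
    Σ (O → BSet) λ A → ((∀ η ζ → η < ζ → ζ < θ → ∀ x → A η x → A ζ x)
          × (∀ η → η < θ → IsOpen (A η))
          × (∀ x → (S x → InD θ A x) × (InD θ A x → S x)))

  -- S is guessable with < α+1 mind changes: H takes values in α+1 = {η | η ≤ α}
  GuessableBelowSucc : O → BSet → Set
  GuessableBelowSucc α S =
    Σ (Seq → Bool) λ G → Σ (Seq → O) λ H → (IsGuesser S G
      × (∀ σ → H σ ≤o α)
      × (∀ f n → H (f ↾ suc n) ≤o H (f ↾ n))
      × (∀ f n → ¬ (G (f ↾ suc n) ≡ G (f ↾ n)) → H (f ↾ suc n) < H (f ↾ n)))

module Submission where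

open import Defs
open import Data.Product using (∃-syntax)
open import Data.Sum using (_⊎_)
open import Relation.Nullary using (¬_; Dec)
open import Relation.Binary.PropositionalEquality using (_≡_)
open import Relation.Binary.Structures using (IsStrictTotalOrder)
open import Induction.WellFounded using (WellFounded)

open import Data.Nat using (ℕ; zero; suc; _≤_; s≤s)
open import Data.Nat.Properties using (n≤1+n)
open import Data.Bool using (Bool; true; false; not)
open import Data.List using (length; _∷_)
open import Data.List.Properties using (length-applyUpTo; ∷-injective)
open import Data.Product using (∃; _×_; _,_; proj₁; proj₂)
open import Data.Sum using (inj₁; inj₂)
open import Data.Empty using (⊥-elim)
open import Function using (_∘_)
open import Induction.WellFounded using (Acc; acc)
open import Relation.Binary.Definitions using (tri<; tri≈; tri>)
open import Relation.Binary.PropositionalEquality using (refl; sym; trans; cong; cong₂; subst)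
open import Relation.Nullary using (yes; no; does)
open import Relation.Nullary.Decidable using (dec-true; dec-false)
open import Relation.Unary using (_∈_; _⊆_)

-- The guesser outputs the label of H(σ), the least η < α whose open set A_η
-- contains the whole cylinder [σ] (or α if there is none).  Extending σ can
-- only make H(σ) smaller, so every mind change lowers H; and along any f, by
-- openness H(f↾n) settles at the least η with f ∈ A_η, whose parity decides
-- membership in D_α.  The family (A_η) need not be increasing for this.

Eventually : (ℕ → Set) → Set
Eventually P = ∃[ N ] (∀ n → N ≤ n → P n)

eventually-map : {P Q : ℕ → Set} → (∀ {n} → P n → Q n) → Eventually P → Eventually Q
eventually-map P⇒Q (N , P-from-N) = N , λ n N≤n → P⇒Q (P-from-N n N≤n)

↾-agree-≤ : ∀ {n m} (f g : Baire) → n ≤ m → g ↾ m ≡ f ↾ m → g ↾ n ≡ f ↾ n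
↾-agree-≤ {zero}  f g _         _   = refl
↾-agree-≤ {suc n} f g (s≤s n≤m) g≡f =
  cong₂ _∷_ (proj₁ (∷-injective g≡f))
            (↾-agree-≤ (f ∘ suc) (g ∘ suc) n≤m (proj₂ (∷-injective g≡f)))

[_] : Seq → BSet
[ σ ] g = g ↾ length σ ≡ σ

agree⇒∈[↾] : ∀ {f g} m → g ↾ m ≡ f ↾ m → g ∈ [ f ↾ m ]
agree⇒∈[↾] {f} {g} m = subst (λ k → g ↾ k ≡ f ↾ m) (sym (length-applyUpTo f m))

∈[↾]⇒agree : ∀ {f g} m → g ∈ [ f ↾ m ] → g ↾ m ≡ f ↾ m
∈[↾]⇒agree {f} {g} m = subst (λ k → g ↾ k ≡ f ↾ m) (length-applyUpTo f m)

∈[↾] : ∀ f m → f ∈ [ f ↾ m ]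
∈[↾] f m = agree⇒∈[↾] m refl

[↾]-antitone : ∀ f {n m} → n ≤ m → [ f ↾ m ] ⊆ [ f ↾ n ]
[↾]-antitone f {n} {m} n≤m {g} g∈ = agree⇒∈[↾] n (↾-agree-≤ f g n≤m (∈[↾]⇒agree m g∈))

open⇒eventually-[↾]⊆ : ∀ {A f} → IsOpen A → A f → Eventually (λ m → [ f ↾ m ] ⊆ A)
open⇒eventually-[↾]⊆ {A} {f} A-open f∈A with A-open f f∈A
... | N , cylinder⊆A =
  N , λ m N≤m g∈ → cylinder⊆A _ (∈[↾]⇒agree N ([↾]-antitone f N≤m g∈))

module WellOrder (dec : (P : Set) → Dec P) {O : Set} {_<_ : O → O → Set}
                 (sto : IsStrictTotalOrder _≡_ _<_) (wf : WellFounded _<_) where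

  open IsStrictTotalOrder sto using (compare; irrefl)

  data IsLeastOr (Q : O → Set) (d : O) : O → Set where
    least : ∀ {η} → Q η → (∀ ζ → ζ < η → ¬ Q ζ) → IsLeastOr Q d η
    none  : (∀ η → ¬ Q η) → IsLeastOr Q d d

  leastOr : (Q : O → Set) (d : O) → ∃ (IsLeastOr Q d)
  leastOr Q d with dec (∃ Q)
  ... | no ∄Q          = d , none (λ η q → ∄Q (η , q))
  ... | yes (η , q) = descend η (wf η) q
    where
    descend : ∀ η → Acc _<_ η → Q η → ∃ (IsLeastOr Q d)
    descend η (acc below) q with dec (∃[ ζ ] (ζ < η × Q ζ))
    ... | yes (ζ , ζ<η , qζ) = descend ζ (below ζ<η) qζ
    ... | no ∄smaller        = η , least q (λ ζ ζ<η qζ → ∄smaller (ζ , ζ<η , qζ))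

  leastOr-unique : ∀ {Q d x y} → IsLeastOr Q d x → IsLeastOr Q d y → x ≡ y
  leastOr-unique (none _)          (none _)          = refl
  leastOr-unique (none ∄Q)         (least qy _)      = ⊥-elim (∄Q _ qy)
  leastOr-unique (least qx _)      (none ∄Q)         = ⊥-elim (∄Q _ qx)
  leastOr-unique {x = x} {y} (least qx x-min) (least qy y-min) with compare x y
  ... | tri< x<y _ _ = ⊥-elim (y-min x x<y qx)
  ... | tri≈ _ x≡y _ = x≡y
  ... | tri> _ _ y<x = ⊥-elim (x-min y y<x qy)

  leastOr-≤ : ∀ {Q d x} → (∀ η → Q η → η < d) → IsLeastOr Q d x → _≤o_ _<_ x d
  leastOr-≤ bounded (least q _) = inj₁ (bounded _ q)
  leastOr-≤ bounded (none _)    = inj₂ refl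

  leastOr-antitone : ∀ {Q Q′ d x x′} → (∀ η → Q η → Q′ η) → (∀ η → Q′ η → η < d)
                   → IsLeastOr Q d x → IsLeastOr Q′ d x′ → _≤o_ _<_ x′ x
  leastOr-antitone _ bounded (none _)    x′-spec = leastOr-≤ bounded x′-spec
  leastOr-antitone Q⊆Q′ _ (least q _) (none ∄Q′) = ⊥-elim (∄Q′ _ (Q⊆Q′ _ q))
  leastOr-antitone {x = x} {x′} Q⊆Q′ bounded (least q _) (least _ x′-min) with compare x′ x
  ... | tri< x′<x _ _ = inj₁ x′<x
  ... | tri≈ _ x′≡x _ = inj₂ x′≡x
  ... | tri> _ _ x<x′ = ⊥-elim (x′-min x x<x′ (Q⊆Q′ _ q))

  module Rank (α : O) (A : O → BSet) (A-open : ∀ η → η < α → IsOpen (A η)) where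

    open IsStrictTotalOrder sto using () renaming (trans to <-trans)

    Member : Baire → O → Set
    Member f η = η < α × A η f

    IsRank : Baire → O → Set
    IsRank f = IsLeastOr (Member f) α

    Covers : Seq → O → Set
    Covers σ η = η < α × [ σ ] ⊆ A η

    H : Seq → O
    H σ = proj₁ (leastOr (Covers σ) α)

    H-spec : ∀ σ → IsLeastOr (Covers σ) α (H σ)
    H-spec σ = proj₂ (leastOr (Covers σ) α)

    H-≤α : ∀ σ → _≤o_ _<_ (H σ) α
    H-≤α σ = leastOr-≤ (λ _ → proj₁) (H-spec σ)

    H-antitone : ∀ f n → _≤o_ _<_ (H (f ↾ suc n)) (H (f ↾ n))
    H-antitone f n = leastOr-antitone covers-extension (λ _ → proj₁)
                                      (H-spec (f ↾ n)) (H-spec (f ↾ suc n))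
      where
      covers-extension : ∀ η → Covers (f ↾ n) η → Covers (f ↾ suc n) η
      covers-extension η (η<α , ⊆Aη) = η<α , ⊆Aη ∘ [↾]-antitone f (n≤1+n n)

    covers⇒member : ∀ {f m η} → Covers (f ↾ m) η → Member f η
    covers⇒member {f} {m} (η<α , ⊆Aη) = η<α , ⊆Aη (∈[↾] f m)

    rank-of-↾ : ∀ {f η} → IsRank f η → Eventually (λ m → IsLeastOr (Covers (f ↾ m)) α η)
    rank-of-↾ (none ∄member) = 0 , λ _ _ → none (λ η → ∄member η ∘ covers⇒member)
    rank-of-↾ (least (η<α , f∈Aη) η-min) =
      eventually-map (λ ⊆Aη → least (η<α , ⊆Aη) (λ ζ ζ<η → η-min ζ ζ<η ∘ covers⇒member))
                     (open⇒eventually-[↾]⊆ (A-open _ η<α) f∈Aη)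

    H-converges : ∀ {f η} → IsRank f η → Eventually (λ m → H (f ↾ m) ≡ η)
    H-converges rank = eventually-map (leastOr-unique (H-spec _)) (rank-of-↾ rank)

    guessable-by-rank : (S : BSet) (c : O → Bool)
      → (∀ {f η} → IsRank f η → (S f → c η ≡ true) × (¬ S f → c η ≡ false))
      → GuessableBelowSucc _<_ α S
    guessable-by-rank S c c-decides-S = c ∘ H , H , guesser , H-≤α , H-antitone , mind-change
      where
      guesser : IsGuesser S (c ∘ H)
      guesser f with leastOr (Member f) α
      ... | η , rank =
        (λ s  → eventually-map (λ H≡η → trans (cong c H≡η) (proj₁ (c-decides-S rank) s))
                               (H-converges rank)) ,
        (λ ¬s → eventually-map (λ H≡η → trans (cong c H≡η) (proj₂ (c-decides-S rank) ¬s))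
                               (H-converges rank))

      mind-change : ∀ f n → ¬ (c (H (f ↾ suc n)) ≡ c (H (f ↾ n))) → H (f ↾ suc n) < H (f ↾ n)
      mind-change f n changed with H-antitone f n
      ... | inj₁ H-dropped = H-dropped
      ... | inj₂ H-stayed  = ⊥-elim (changed (cong c H-stayed))

    Labelled : O → Set
    Labelled η = η < α × ∃[ b ] (Parity _<_ η b × Parity _<_ α (not b))

    label : O → Bool
    label η = does (dec (Labelled η))

    InD⇒labelled : ∀ {f η} → IsRank f η → InD _<_ α A f → Labelled η
    InD⇒labelled rank (ζ , ζ<α , f∈Aζ , ζ-min , parities) =
      subst Labelled ζ≡η (ζ<α , parities)
      where
      ζ≡η = leastOr-unique (least (ζ<α , f∈Aζ) (λ ξ ξ<ζ → ζ-min ξ ξ<ζ ∘ proj₂)) rank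

    labelled⇒InD : ∀ {f η} → IsRank f η → Labelled η → InD _<_ α A f
    labelled⇒InD (none _) (α<α , _) = ⊥-elim (irrefl refl α<α)
    labelled⇒InD (least (η<α , f∈Aη) η-min) (_ , parities) =
      _ , η<α , f∈Aη , (λ ζ ζ<η f∈Aζ → η-min ζ ζ<η (<-trans ζ<η η<α , f∈Aζ)) , parities

corollary4p5 : ((P : Set) → Dec P)
    → (O : Set) (_<_ : O → O → Set)
    → IsStrictTotalOrder _≡_ _<_ → WellFounded _<_
    → (α : O) → ∃[ η ] (η < α)
    → (S : BSet)
    → InClassD _<_ α S ⊎ InClassD _<_ α (λ x → ¬ S x)
    → GuessableBelowSucc _<_ α S
corollary4p5 dec O _<_ sto wf α _ S (inj₁ (A , _ , A-open , S⇔D)) =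
  guessable-by-rank S label λ rank →
    (λ s  → dec-true  (dec _) (InD⇒labelled rank (proj₁ (S⇔D _) s))) ,
    (λ ¬s → dec-false (dec _) (¬s ∘ proj₂ (S⇔D _) ∘ labelled⇒InD rank))
  where open WellOrder dec sto wf
        open Rank α A A-open
corollary4p5 dec O _<_ sto wf α _ S (inj₂ (A , _ , A-open , ¬S⇔D)) =
  guessable-by-rank S (not ∘ label) λ rank →
    (λ s  → cong not (dec-false (dec _) (λ l → proj₂ (¬S⇔D _) (labelled⇒InD rank l) s))) ,
    (λ ¬s → cong not (dec-true  (dec _) (InD⇒labelled rank (proj₁ (¬S⇔D _) ¬s))))
  where open WellOrder dec sto wf
        open Rank α A A-open
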